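{- Let $k\ge r\ge3$, $m\geq 0$, and let $\pi\in\mathbb{C}_{=}(k,r|m)$. Then for every integer $m'\ge0$, $\pi\in\mathbb{C}_{<}(k,r|m')$ if and only if $m<m'$.
   Context: A partition is a finite non-increasing sequence of positive integers. $\mathbb{C}(k,r)$ is the set of partitions $\pi=(\pi_1,\dots,\pi_\ell)$ with no repeated odd part, $\pi_i\ge\pi_{i+k-1}+2$ for $1\le i\le\ell-k+1$ (strict if $\pi_i$ even), and at most $r-1$ parts $\le2$. Göllnitz–Gordon marking $GG(\pi)$: marks (positive integers) are assigned to the parts from smallest to largest, each as small as possible subject to: the mark of $\pi_i$ differs from the marks of all parts $\pi_g$, $g>i$, with $\pi_i-\pi_g\le2$ (strict if $\pi_i$ odd). A "$j$-marked $x$" is a part $x$ with mark $j$. $N_j$ is the number of $j$-marked parts and $\pi^{(j)}_1>\cdots>\pi^{(j)}_{N_j}$ are these parts; $\pi^{(j)}_0=+\infty$, $\pi^{(j)}_{N_j+1}=-\infty$. Starting types (for $N_2\ge1$): let $l$ be the largest integer $0\le l\le N_2$ such that no odd part of $\pi$ is $\ge\pi^{(2)}_l$; parts $\pi^{(2)}_i$, $i>l$, are of type $s_{ -1}$. For $b=1$: $\pi^{(2)}_1$ is of type $s_0$ [resp. $s_1$] with $s_1(\pi)=\pi^{(2)}_1-1$ [resp. $-2$] if there is a 1-marked $\pi^{(2)}_1-1$ [resp. $\pi^{(2)}_1-2$] and $\pi^{(2)}_1+2$ does not occur; of type $s_2$ ($s_1(\pi)=\pi^{(2)}_1+2$) if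 there is a 1-marked $\pi^{(2)}_1+2$; of type $s_3$ ($s_1(\pi)=\pi^{(2)}_1$) if there is a 1-marked $\pi^{(2)}_1$. For $b=2,\dots,l$: type $s_0$ [resp. $s_1$], $s_b(\pi)=\pi^{(2)}_b-1$ [resp. $-2$], if there is a 1-marked $\pi^{(2)}_b-1$ [resp. $-2$] and, whenever a 1-marked $\pi^{(2)}_b+2$ exists, $s_{b-1}(\pi)=\pi^{(2)}_b+2$; type $s_2$ ($s_b(\pi)=\pi^{(2)}_b+2$) if there is a 1-marked $\pi^{(2)}_b+2$ and $s_{b-1}(\pi)\neq\pi^{(2)}_b+2$; type $s_3$ ($s_b(\pi)=\pi^{(2)}_b$) if there is a 1-marked $\pi^{(2)}_b$. For $p,t\ge0$: $\mathbb{C}_{<}(k,r|p,t)$ is the set of $\pi\in\mathbb{C}(k,r)$ such that (1) no odd part is $\ge2t+1$; (2) $\pi^{(2)}_{p+1}<2t+1<\pi^{(2)}_p$; (3) if $\pi^{(2)}_p=2t+2$ it is of starting type $s_2$ or $s_3$; (4) if $\pi^{(2)}_{p+1}=2t$ it is of starting type $s_0$ or $s_1$. $\mathbb{C}_{=}(k,r|p,t)$ is the set of $\pi\in\mathbb{C}(k,r)$ such that (1) the largest odd part is $2t+1$; (2) the mark of $2t+1$ is at most 2; (3) $\pi^{(2)}_p\ge2t+2$ and $\pi^{(2)}_{p+1}\le2t+2$; (4) if there is a 2-marked $2t+2$ of starting type $s_0$, then $\pi^{(2)}_{p+1}=2t+2$ and there is $i\le p+1$ with $\pi^{(2)}_i=\pi^{(2)}_{p+1}+4(p-i+1)$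 and $\pi^{(2)}_i$ occurring exactly once in $\pi$; (5) if there is a 2-marked $2t+2$ of starting type $s_2$, then $\pi^{(2)}_p=2t+2$; (6) if $2t+2$ occurs and there is no 2-marked $2t+2$, then $\pi^{(2)}_p=2t+4$ is of type $s_3$ and there is $i\le p$ with $\pi^{(2)}_i=\pi^{(2)}_p+4(p-i)$ and $\pi^{(2)}_i+2$ not occurring in $\pi$. For $m\ge0$: $\mathbb{C}_{<}(k,r|m)=\bigcup_{p+t=m}\mathbb{C}_{<}(k,r|p,t)$ and $\mathbb{C}_{=}(k,r|m)=\bigcup_{p+t=m}\mathbb{C}_{=}(k,r|p,t)$, unions over $p,t\ge0$. -}

module Defs where

open import Data.Bool using (Bool; true; false; if_then_else_; T; not)
open import Data.Nat using (ℕ; zero; suc; _+_; _*_; _∸_; _≤_; _<_; _≤ᵇ_; _<ᵇ_; _≡ᵇ_)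
open import Data.List using (List; []; _∷_; length; map; reverse; filterᵇ)
open import Data.List.Relation.Unary.All using (All)
open import Data.List.Membership.Propositional using (_∈_)
open import Data.Product using (Σ; _×_; _,_; proj₁; proj₂; ∃)
open import Data.Sum using (_⊎_)
open import Data.Unit using (⊤)
open import Data.Empty using (⊥)
open import Relation.Nullary using (¬_)
open import Relation.Binary.PropositionalEquality using (_≡_)

isOdd : ℕ → Bool
isOdd zero          = false
isOdd (suc zero)    = true
isOdd (suc (suc n)) = isOdd n

Odd : ℕ → Set
Odd n = T (isOdd n)

Even : ℕ → Set
Even n = T (not (isOdd n))

count : ℕ → List ℕ → ℕ
count x xs = length (filterᵇ (λ y → y ≡ᵇ x) xs)

-- 0-based access with default 0 (only used under explicit index guards)
nth : List ℕ → ℕ → ℕ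
nth []       _       = 0
nth (x ∷ xs) zero    = x
nth (x ∷ xs) (suc i) = nth xs i

IsPartition : List ℕ → Set
IsPartition π =
  All (λ x → 1 ≤ x) π ×
  (∀ i → suc i < length π → nth π (suc i) ≤ nth π i)

InC : ℕ → ℕ → List ℕ → Set
InC k r π =
  IsPartition π ×
  (∀ x → Odd x → count x π ≤ 1) ×
  -- π_i ≥ π_{i+k-1} + 2 (strict if π_i even), 1 ≤ i ≤ ℓ-k+1 (here 0-based i)
  (∀ i → i + (k ∸ 1) < length π →
     (Even (nth π i) → nth π (i + (k ∸ 1)) + 2 < nth π i) ×
     (nth π (i + (k ∸ 1)) + 2 ≤ nth π i)) ×
  (suc (length (filterᵇ (λ y → y ≤ᵇ 2) π)) ≤ r)

-- does the part x (being marked) have to get a mark different from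
-- that of the (already marked, not larger) part y?  x - y ≤ 2, strict if x odd.
conflicts : ℕ → ℕ → Bool
conflicts x y = if isOdd x then (x ∸ y) <ᵇ 2 else (x ∸ y) ≤ᵇ 2

elemᵇ : ℕ → List ℕ → Bool
elemᵇ x []       = false
elemᵇ x (y ∷ ys) = if x ≡ᵇ y then true else elemᵇ x ys

-- smallest j ≥ start not in L (fuel suffices when fuel > length L)
search : ℕ → ℕ → List ℕ → ℕ
search zero       j L = j
search (suc fuel) j L = if elemᵇ j L then search fuel (suc j) L else j

smallestFree : List ℕ → ℕ
smallestFree L = search (suc (length L)) 1 L

-- acc: already marked (part , mark) pairs; input: remaining parts, smallest first
markRev : List (ℕ × ℕ) → List ℕ → List (ℕ × ℕ)
markRev acc []       = acc
markRev acc (x ∷ xs) =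
  markRev ((x , smallestFree (map proj₂ (filterᵇ (λ q → conflicts x (proj₁ q)) acc))) ∷ acc) xs

-- GG π : list of (part , mark), aligned with π (largest part first)
GG : List ℕ → List (ℕ × ℕ)
GG π = markRev [] (reverse π)

-- the j-marked parts π^{(j)}_1 > π^{(j)}_2 > ⋯ > π^{(j)}_{N_j}
markedParts : ℕ → List ℕ → List ℕ
markedParts j π = map proj₁ (filterᵇ (λ q → proj₂ q ≡ᵇ j) (GG π))

N : ℕ → List ℕ → ℕ
N j π = length (markedParts j π)

Marked : ℕ → ℕ → List ℕ → Set
Marked j x π = (x , j) ∈ GG π

-- Extended naturals for π^{(j)}_0 = +∞, π^{(j)}_{N_j+1} = -∞

data Ext : Set where
  minf : Ext
  fin  : ℕ → Ext
  pinf : Ext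

_≤ᴱ_ : Ext → Ext → Set
minf  ≤ᴱ _     = ⊤
fin m ≤ᴱ minf  = ⊥
fin m ≤ᴱ fin n = m ≤ n
fin m ≤ᴱ pinf  = ⊤
pinf  ≤ᴱ pinf  = ⊤
pinf  ≤ᴱ _     = ⊥

_<ᴱ_ : Ext → Ext → Set
minf  <ᴱ minf  = ⊥
minf  <ᴱ _     = ⊤
fin m <ᴱ minf  = ⊥
fin m <ᴱ fin n = m < n
fin m <ᴱ pinf  = ⊤
pinf  <ᴱ _     = ⊥

-- 1-based access: index 0 ↦ +∞, 1..N ↦ entries, larger ↦ -∞
atE : List ℕ → ℕ → Ext
atE xs zero = pinf
atE [] (suc i) = minf
atE (x ∷ xs) (suc zero) = fin x
atE (x ∷ xs) (suc (suc i)) = atE xs (suc i)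

P : ℕ → List ℕ → ℕ → Ext
P j π i = atE (markedParts j π) i

NoOddGe : List ℕ → ℕ → Set
NoOddGe π l = ∀ y → y ∈ π → Odd y → ¬ (P 2 π l ≤ᴱ fin y)

IsL : List ℕ → ℕ → Set
IsL π l = l ≤ N 2 π × NoOddGe π l ×
          (∀ l' → l' ≤ N 2 π → NoOddGe π l' → l' ≤ l)

InL : List ℕ → ℕ → Set
InL π b = 1 ≤ b × Σ ℕ (λ l → IsL π l × b ≤ l)

data STy : Set where
  s0 s1 s2 s3 : STy

-- value s_b(π) for the part x = π^{(2)}_b of type c
sval : ℕ → STy → ℕ
sval x s0 = x ∸ 1
sval x s1 = x ∸ 2
sval x s2 = x + 2
sval x s3 = x

-- π^{(2)}_b as a natural number (default 0 outside 1..N₂; only used for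
-- b with 1 ≤ b ≤ l ≤ N₂)
P2 : List ℕ → ℕ → ℕ
P2 π b = nth (markedParts 2 π) (b ∸ 1)

mutual
  HasType : List ℕ → ℕ → STy → Set
  HasType π b c = InL π b × TypeCond π b c

  SIs : List ℕ → ℕ → ℕ → Set
  SIs π b v = Σ STy (λ c → HasType π b c × sval (P2 π b) c ≡ v)

  TypeCond : List ℕ → ℕ → STy → Set
  TypeCond π zero c = ⊥
  TypeCond π (suc zero) s0 =
    Marked 1 (P2 π 1 ∸ 1) π × ¬ (P2 π 1 + 2 ∈ π)
  TypeCond π (suc zero) s1 =
    Marked 1 (P2 π 1 ∸ 2) π × ¬ (P2 π 1 + 2 ∈ π)
  TypeCond π (suc zero) s2 = Marked 1 (P2 π 1 + 2) π
  TypeCond π (suc zero) s3 = Marked 1 (P2 π 1) π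
  TypeCond π (suc (suc n)) s0 =
    Marked 1 (P2 π (suc (suc n)) ∸ 1) π ×
    (Marked 1 (P2 π (suc (suc n)) + 2) π → SIs π (suc n) (P2 π (suc (suc n)) + 2))
  TypeCond π (suc (suc n)) s1 =
    Marked 1 (P2 π (suc (suc n)) ∸ 2) π ×
    (Marked 1 (P2 π (suc (suc n)) + 2) π → SIs π (suc n) (P2 π (suc (suc n)) + 2))
  TypeCond π (suc (suc n)) s2 =
    Marked 1 (P2 π (suc (suc n)) + 2) π ×
    ¬ SIs π (suc n) (P2 π (suc (suc n)) + 2)
  TypeCond π (suc (suc n)) s3 = Marked 1 (P2 π (suc (suc n))) π

TwoMarkedOfType : List ℕ → ℕ → STy → Set
TwoMarkedOfType π x c = Σ ℕ (λ b → P 2 π b ≡ fin x × HasType π b c)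

InClt : ℕ → ℕ → ℕ → ℕ → List ℕ → Set
InClt k r p t π =
  InC k r π ×
  -- (1)
  (∀ y → y ∈ π → Odd y → y < 2 * t + 1) ×
  -- (2)
  (P 2 π (suc p) <ᴱ fin (2 * t + 1)) × (fin (2 * t + 1) <ᴱ P 2 π p) ×
  -- (3)
  (P 2 π p ≡ fin (2 * t + 2) → HasType π p s2 ⊎ HasType π p s3) ×
  -- (4)
  (P 2 π (suc p) ≡ fin (2 * t) → HasType π (suc p) s0 ⊎ HasType π (suc p) s1)

InCeq : ℕ → ℕ → ℕ → ℕ → List ℕ → Set
InCeq k r p t π =
  InC k r π ×
  -- (1) the largest odd part is 2t+1
  ((2 * t + 1) ∈ π × (∀ y → y ∈ π → Odd y → y ≤ 2 * t + 1)) ×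
  -- (2) the mark of 2t+1 is at most 2
  (Σ ℕ (λ j → Marked j (2 * t + 1) π × j ≤ 2)) ×
  -- (3)
  (fin (2 * t + 2) ≤ᴱ P 2 π p) × (P 2 π (suc p) ≤ᴱ fin (2 * t + 2)) ×
  -- (4)
  (TwoMarkedOfType π (2 * t + 2) s0 →
     P 2 π (suc p) ≡ fin (2 * t + 2) ×
     Σ ℕ (λ i → 1 ≤ i × i ≤ suc p ×
        P 2 π i ≡ fin (2 * t + 2 + 4 * (suc p ∸ i)) ×
        count (2 * t + 2 + 4 * (suc p ∸ i)) π ≡ 1)) ×
  -- (5)
  (TwoMarkedOfType π (2 * t + 2) s2 → P 2 π p ≡ fin (2 * t + 2)) ×
  -- (6)
  ((2 * t + 2) ∈ π → ¬ Marked 2 (2 * t + 2) π →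
     P 2 π p ≡ fin (2 * t + 4) × HasType π p s3 ×
     Σ ℕ (λ i → 1 ≤ i × i ≤ p ×
        P 2 π i ≡ fin (2 * t + 4 + 4 * (p ∸ i)) ×
        ¬ ((2 * t + 4 + 4 * (p ∸ i)) + 2 ∈ π)))

InCltM : ℕ → ℕ → ℕ → List ℕ → Set
InCltM k r m π = Σ ℕ (λ p → Σ ℕ (λ t → p + t ≡ m × InClt k r p t π))

InCeqM : ℕ → ℕ → ℕ → List ℕ → Set
InCeqM k r m π = Σ ℕ (λ p → Σ ℕ (λ t → p + t ≡ m × InCeq k r p t π))

-- The 2-marked parts of π lying above its largest odd part 2t+1 are even and pairwise
-- non-conflicting, so consecutive ones differ by at least 3.
--
-- (⇒) If π ∈ ℂ_<(p′,t′) then t < t′, since 2t+1 is a part.  When p > p′, the parts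
-- π⁽²⁾_{p′+1} > ⋯ > π⁽²⁾_p all lie between 2t+2 and 2t′, which forces p+t < p′+t′
-- except when π⁽²⁾_{p′+1} = 2t+2 = 2t′.  Condition (4) of ℂ_< then makes that part of
-- type s0 or s1: s0 would, by condition (4) of ℂ_=, put a second 2-marked 2t+2 at index
-- p+1, and s1 would make both 2t and 2t+1 1-marked.
--
-- (⇐) Given m′ > p+t, let q ≤ p be the largest index with 2(m′−q)+1 < π⁽²⁾_q.  Then
-- π ∈ ℂ_<(q, m′−q), unless π⁽²⁾_q = 2(m′−q)+2 is of starting type s1, in which case
-- π ∈ ℂ_<(q−1, m′−q+1).

module Submission where

open import Defs
open import Data.Bool using (true; false; T; not)
open import Data.Bool.Properties using (not-injective)
open import Data.Empty using (⊥-elim)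
open import Data.List using (List; []; _∷_; length; map; reverse; filterᵇ; _++_)
import Data.List.Membership.DecPropositional as DecMembership
open import Data.List.Membership.Propositional using (_∈_; _∉_)
open import Data.List.Membership.Propositional.Properties
  using (∈-map⁺; ∈-map⁻; ∈-filter⁺; ∈-filter⁻)
open import Data.List.Properties using (reverse-involutive; ++-identityʳ; unfold-reverse; ++-assoc)
open import Data.List.Relation.Unary.All as All using (All; []; _∷_)
open import Data.List.Relation.Unary.All.Properties using (all-filter)
open import Data.List.Relation.Unary.AllPairs as AllPairs using (AllPairs; []; _∷_)
import Data.List.Relation.Unary.AllPairs.Properties as AllPairsₚ
open import Data.List.Relation.Unary.Any using (here; there)
open import Data.List.Relation.Unary.Linked using (Linked; []; [-]; _∷_)
open import Data.List.Relation.Unary.Linked.Properties using (Linked⇒AllPairs)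
open import Data.Nat
  using (ℕ; zero; suc; _+_; _*_; _∸_; _≤_; _<_; _≥_; _>_; _≡ᵇ_; _≟_; _≤?_; _<?_; z≤n; s≤s)
open import Data.Nat.Properties
open import Data.Nat.Tactic.RingSolver using (solve-∀)
open import Data.Product using (∃; _×_; _,_; proj₁; proj₂)
open import Data.Product.Properties using (≡-dec)
open import Data.Sum using (_⊎_; inj₁; inj₂)
open import Data.Unit using (tt)
open import Function using (_on_; _∘′_)
open import Function.Bundles using (_⇔_; mk⇔)
open import Relation.Binary.PropositionalEquality
open import Relation.Nullary using (¬_; Dec; yes; no)
open import Relation.Nullary.Decidable using (T?; ¬?; _×-dec_; _→-dec_; decidable-stable)

open DecMembership _≟_ using (_∈?_)
open DecMembership (≡-dec _≟_ _≟_) using () renaming (_∈?_ to _∈ₚ?_)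

largest-≤ : {Q : ℕ → Set} → (∀ n → Dec (Q n)) → Q 0 → ∀ n →
  ∃ λ l → l ≤ n × Q l × (∀ l′ → l′ ≤ n → Q l′ → l′ ≤ l)
largest-≤ Q? q₀ zero = 0 , z≤n , q₀ , λ _ l′≤0 _ → l′≤0
largest-≤ {Q} Q? q₀ (suc n) with Q? (suc n) | largest-≤ Q? q₀ n
... | yes q | _                    = suc n , ≤-refl , q , λ _ l′≤ _ → l′≤
... | no ¬q | l , l≤n , ql , maximal = l , m≤n⇒m≤1+n l≤n , ql , maximal′
  where
  maximal′ : ∀ l′ → l′ ≤ suc n → Q l′ → l′ ≤ l
  maximal′ l′ l′≤ ql′ with m≤n⇒m<n∨m≡n l′≤
  ... | inj₁ l′<  = maximal l′ (≤-pred l′<) ql′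
  ... | inj₂ refl = ⊥-elim (¬q ql′)

<+1⇒≤ : ∀ {a b} → a < b + 1 → a ≤ b
<+1⇒≤ {a} {b} a<b+1 = m<1+n⇒m≤n (subst (a <_) (+-comm b 1) a<b+1)

between⇒≡∨≡suc∨≡+2 : ∀ {y v} → y ≤ v → v ≤ y + 2 →
  v ≡ y ⊎ v ≡ suc y ⊎ v ≡ y + 2
between⇒≡∨≡suc∨≡+2 {y} {v} y≤v v≤y+2 with m≤n⇒m<n∨m≡n y≤v
... | inj₂ y≡v = inj₁ (sym y≡v)
... | inj₁ y<v with m≤n⇒m<n∨m≡n y<v
...   | inj₂ 1+y≡v = inj₂ (inj₁ (sym 1+y≡v))
...   | inj₁ 1+y<v = inj₂ (inj₂ (≤-antisym v≤y+2 (subst (_≤ v) (+-comm 2 y) 1+y<v)))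

2*suc : ∀ t → 2 * suc t ≡ 2 * t + 2
2*suc = solve-∀

2t+2+2≡2*suc+2 : ∀ t → 2 * t + 2 + 2 ≡ 2 * suc t + 2
2t+2+2≡2*suc+2 = solve-∀

2t+1<2t+2 : ∀ t → 2 * t + 1 < 2 * t + 2
2t+1<2t+2 t = +-monoʳ-< (2 * t) ≤-refl

2s+1<2*suc : ∀ s → 2 * s + 1 < 2 * suc s
2s+1<2*suc s = ≤-reflexive (e s)
  where
  e : ∀ s → suc (2 * s + 1) ≡ 2 * suc s
  e = solve-∀

2t+2<2*suc+1 : ∀ t → 2 * t + 2 < 2 * suc t + 1
2t+2<2*suc+1 t = ≤-reflexive (e t)
  where
  e : ∀ t → suc (2 * t + 2) ≡ 2 * suc t + 1
  e = solve-∀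

2t+1<2t′+1⇒t<t′ : ∀ {t t′} → 2 * t + 1 < 2 * t′ + 1 → t < t′
2t+1<2t′+1⇒t<t′ {t} {t′} lt = *-cancelˡ-< 2 t t′ (+-cancelʳ-< 1 (2 * t) (2 * t′) lt)

t<t′⇒2t+1<2t′+1 : ∀ {t t′} → t < t′ → 2 * t + 1 < 2 * t′ + 1
t<t′⇒2t+1<2t′+1 t<t′ = +-monoˡ-< 1 (*-monoʳ-< 2 t<t′)

t<t′⇒2t+2<2t′+2 : ∀ {t t′} → t < t′ → 2 * t + 2 < 2 * t′ + 2
t<t′⇒2t+2<2t′+2 t<t′ = +-monoˡ-< 2 (*-monoʳ-< 2 t<t′)

t<t′⇒2t+1<2t′+2 : ∀ {t t′} → t < t′ → 2 * t + 1 < 2 * t′ + 2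
t<t′⇒2t+1<2t′+2 {t} t<t′ = <-trans (2t+1<2t+2 t) (t<t′⇒2t+2<2t′+2 t<t′)

t<t′⇒2t+2≤2t′ : ∀ {t t′} → t < t′ → 2 * t + 2 ≤ 2 * t′
t<t′⇒2t+2≤2t′ {t} {t′} t<t′ = subst (_≤ 2 * t′) (2*suc t) (*-monoʳ-≤ 2 t<t′)

t<m′∸q : ∀ {p q t m′} → q ≤ p → p + t < m′ → t < m′ ∸ q
t<m′∸q {p} {q} {t} {m′} q≤p p+t<m′ =
  ≤-trans (m+n≤o⇒m≤o∸n (suc t) (subst (λ x → suc x ≤ m′) (+-comm p t) p+t<m′))
          (∸-monoʳ-≤ m′ q≤p)

q+[m′∸q]≡m′ : ∀ {p q t m′} → q ≤ p → p + t < m′ → q + (m′ ∸ q) ≡ m′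
q+[m′∸q]≡m′ {t = t} q≤p p+t<m′ =
  m+[n∸m]≡n (≤-trans q≤p (≤-trans (m≤m+n _ t) (<⇒≤ p+t<m′)))

squeeze : ∀ {t t′ d a} → 2 * t + 2 + 3 * d ≤ a → a ≤ 2 * t′ → t′ ≤ suc d + t →
  a ≡ 2 * t + 2 × 2 * t′ ≡ 2 * t + 2
squeeze {t} {t′} {d} {a} lower a≤2t′ t′≤ =
  ≤-antisym (≤-trans a≤2t′ 2t′≤2t+2) 2t+2≤a , ≤-antisym 2t′≤2t+2 (≤-trans 2t+2≤a a≤2t′)
  where
  double : ∀ t d → 2 * (suc d + t) ≡ 2 * t + 2 + 2 * d
  double = solve-∀
  2t′≤ : 2 * t′ ≤ 2 * t + 2 + 2 * d
  2t′≤ = ≤-trans (*-monoʳ-≤ 2 t′≤) (≤-reflexive (double t d))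
  d≡0 : d ≡ 0
  d≡0 = n≤0⇒n≡0 (+-cancelʳ-≤ (2 * d) d 0
          (+-cancelˡ-≤ (2 * t + 2) (3 * d) (2 * d) (≤-trans lower (≤-trans a≤2t′ 2t′≤))))
  2t′≤2t+2 : 2 * t′ ≤ 2 * t + 2
  2t′≤2t+2 =
    ≤-trans 2t′≤ (≤-reflexive (trans (cong (λ d → 2 * t + 2 + 2 * d) d≡0) (+-identityʳ _)))
  2t+2≤a : 2 * t + 2 ≤ a
  2t+2≤a = ≤-trans (m≤m+n (2 * t + 2) (3 * d)) lower

isOdd-suc : ∀ n → isOdd (suc n) ≡ not (isOdd n)
isOdd-suc zero          = refl
isOdd-suc (suc zero)    = refl
isOdd-suc (suc (suc n)) = isOdd-suc n

isOdd-+2 : ∀ n → isOdd (n + 2) ≡ isOdd n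
isOdd-+2 n = cong isOdd (+-comm n 2)

isOdd-2* : ∀ t → isOdd (2 * t) ≡ false
isOdd-2* zero    = refl
isOdd-2* (suc t) rewrite *-suc 2 t = isOdd-2* t

isOdd-2*+1 : ∀ t → isOdd (2 * t + 1) ≡ true
isOdd-2*+1 t rewrite +-comm (2 * t) 1 | isOdd-suc (2 * t) | isOdd-2* t = refl

isOdd-2*+2 : ∀ t → isOdd (2 * t + 2) ≡ false
isOdd-2*+2 t = trans (isOdd-+2 (2 * t)) (isOdd-2* t)

Conflicts : ℕ → ℕ → Set
Conflicts x y = T (conflicts x y)

≤+1⇒Conflicts : ∀ {x y} → x ≤ y + 1 → Conflicts x y
≤+1⇒Conflicts {x} {y} x≤y+1 with isOdd x
... | true  = <⇒<ᵇ (s≤s (m≤n+o⇒m∸n≤o x y x≤y+1))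
... | false = ≤⇒≤ᵇ (m≤n⇒m≤1+n (m≤n+o⇒m∸n≤o x y x≤y+1))

Conflicts-refl : ∀ x → Conflicts x x
Conflicts-refl x = ≤+1⇒Conflicts (m≤m+n x 1)

module _ {x y : ℕ} (x-even : isOdd x ≡ false) where

  Conflicts-even⇒≤ : Conflicts x y → x ≤ y + 2
  Conflicts-even⇒≤ c rewrite x-even =
    ≤-trans (m≤n+m∸n x y) (+-monoʳ-≤ y (≤ᵇ⇒≤ (x ∸ y) 2 c))

  ≤⇒Conflicts-even : x ≤ y + 2 → Conflicts x y
  ≤⇒Conflicts-even x≤y+2 rewrite x-even = ≤⇒≤ᵇ (m≤n+o⇒m∸n≤o x y x≤y+2)

  ¬Conflicts-even⇒< : ¬ Conflicts x y → y + 2 < x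
  ¬Conflicts-even⇒< ¬c = ≰⇒> (λ x≤y+2 → ¬c (≤⇒Conflicts-even x≤y+2))

-- The Göllnitz–Gordon marking

allPairs-either : ∀ {A : Set} {R : A → A → Set} {xs u w} →
  AllPairs R xs → u ∈ xs → w ∈ xs → u ≢ w → R u w ⊎ R w u
allPairs-either (_ ∷ _)   (here refl) (here refl) u≢w = ⊥-elim (u≢w refl)
allPairs-either (Ru ∷ _)  (here refl) (there w∈)  _   = inj₁ (All.lookup Ru w∈)
allPairs-either (Rw ∷ _)  (there u∈)  (here refl) _   = inj₂ (All.lookup Rw u∈)
allPairs-either (_ ∷ Rxs) (there u∈)  (there w∈)  u≢w = allPairs-either Rxs u∈ w∈ u≢w

allPairs-restrict : ∀ {A : Set} {P : A → Set} {R S : A → A → Set} {xs} →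
  (∀ {x y} → P x → P y → R x y → S x y) → All P xs → AllPairs R xs → AllPairs S xs
allPairs-restrict f []         []         = []
allPairs-restrict f (px ∷ pxs) (Rx ∷ Rxs) =
  All.zipWith (λ (py , Rxy) → f px py Rxy) (pxs , Rx) ∷ allPairs-restrict f pxs Rxs

elemᵇ⇒∈ : ∀ {x} ys → T (elemᵇ x ys) → x ∈ ys
elemᵇ⇒∈ {x} (y ∷ ys) h with x ≡ᵇ y in x≡ᵇy
... | true  = here (≡ᵇ⇒≡ x y (subst T (sym x≡ᵇy) tt))
... | false = there (elemᵇ⇒∈ ys h)

∈⇒elemᵇ : ∀ {x ys} → x ∈ ys → T (elemᵇ x ys)
∈⇒elemᵇ {x} {y ∷ ys} x∈ with x ≡ᵇ y in x≡ᵇy | x∈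
... | true  | _          = tt
... | false | here refl  = ⊥-elim (subst T x≡ᵇy (≡⇒≡ᵇ x x refl))
... | false | there x∈ys = ∈⇒elemᵇ x∈ys

j≤search : ∀ fuel j L → j ≤ search fuel j L
j≤search zero       j L = ≤-refl
j≤search (suc fuel) j L with elemᵇ j L
... | true  = ≤-trans (n≤1+n j) (j≤search fuel (suc j) L)
... | false = ≤-refl

smallestFree-positive : ∀ L → 1 ≤ smallestFree L
smallestFree-positive L = j≤search (suc (length L)) 1 L

1∉⇒smallestFree≡1 : ∀ L → 1 ∉ L → smallestFree L ≡ 1
1∉⇒smallestFree≡1 L 1∉L with elemᵇ 1 L in 1∈ᵇL
... | false = refl
... | true  = ⊥-elim (1∉L (elemᵇ⇒∈ L (subst T (sym 1∈ᵇL) tt)))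

smallestFree≢1⇒1∈ : ∀ L → smallestFree L ≢ 1 → 1 ∈ L
smallestFree≢1⇒1∈ L ≢1 with 1 ∈? L
... | yes 1∈L = 1∈L
... | no  1∉L = ⊥-elim (≢1 (1∉⇒smallestFree≡1 L 1∉L))

-- Only marks 1 and 2 are ever needed; for them freeness is read off from two unfoldings
-- of `search`, with no counting argument.
smallestFree≤2⇒∉ : ∀ L → smallestFree L ≤ 2 → smallestFree L ∉ L
smallestFree≤2⇒∉ (y ∷ L) ≤2 ∈L with elemᵇ 1 (y ∷ L) in 1∈ᵇL
... | false = subst T 1∈ᵇL (∈⇒elemᵇ ∈L)
... | true with elemᵇ 2 (y ∷ L) in 2∈ᵇL
...   | false = subst T 2∈ᵇL (∈⇒elemᵇ ∈L)
...   | true  = ≤⇒≯ ≤2 (j≤search (length L) 3 (y ∷ L))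

conflictingMarks : ℕ → List (ℕ × ℕ) → List ℕ
conflictingMarks x acc = map proj₂ (filterᵇ (λ q → conflicts x (proj₁ q)) acc)

∈-conflictingMarks⁻ : ∀ {a x} acc → a ∈ conflictingMarks x acc →
  ∃ λ y → (y , a) ∈ acc × Conflicts x y
∈-conflictingMarks⁻ {x = x} acc a∈ with ∈-map⁻ proj₂ a∈
... | (y , _) , ya∈ , refl = y , ∈-filter⁻ (λ q → T? (conflicts x (proj₁ q))) ya∈

∈-conflictingMarks⁺ : ∀ {a x y acc} → (y , a) ∈ acc → Conflicts x y → a ∈ conflictingMarks x acc
∈-conflictingMarks⁺ {x = x} ya∈ c =
  ∈-map⁺ proj₂ (∈-filter⁺ (λ q → T? (conflicts x (proj₁ q))) ya∈ c)

data Greedy : List (ℕ × ℕ) → Set where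
  []  : Greedy []
  _∷_ : ∀ x {acc} → Greedy acc → Greedy ((x , smallestFree (conflictingMarks x acc)) ∷ acc)

markRev-greedy : ∀ {acc} xs → Greedy acc → Greedy (markRev acc xs)
markRev-greedy []       g = g
markRev-greedy (x ∷ xs) g = markRev-greedy xs (x ∷ g)

GG-greedy : ∀ π → Greedy (GG π)
GG-greedy π = markRev-greedy (reverse π) []

map-proj₁-markRev : ∀ acc xs → map proj₁ (markRev acc xs) ≡ reverse xs ++ map proj₁ acc
map-proj₁-markRev acc []       = refl
map-proj₁-markRev acc (x ∷ xs) = begin
  map proj₁ (markRev _ xs)                 ≡⟨ map-proj₁-markRev _ xs ⟩
  reverse xs ++ (x ∷ map proj₁ acc)        ≡⟨ ++-assoc (reverse xs) (x ∷ []) (map proj₁ acc) ⟨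
  (reverse xs ++ x ∷ []) ++ map proj₁ acc  ≡⟨ cong (_++ map proj₁ acc) (unfold-reverse x xs) ⟨
  reverse (x ∷ xs) ++ map proj₁ acc        ∎
  where open ≡-Reasoning

GG-parts : ∀ π → map proj₁ (GG π) ≡ π
GG-parts π =
  trans (map-proj₁-markRev [] (reverse π)) (trans (++-identityʳ _) (reverse-involutive π))

Marked⇒∈ : ∀ {j x π} → Marked j x π → x ∈ π
Marked⇒∈ {π = π} m = subst (_ ∈_) (GG-parts π) (∈-map⁺ proj₁ m)

greedy-positive : ∀ {G x a} → Greedy G → (x , a) ∈ G → 1 ≤ a
greedy-positive (_∷_ x {acc} _) (here refl) = smallestFree-positive (conflictingMarks x acc)
greedy-positive (_ ∷ g)         (there m)   = greedy-positive g m

Marked⇒positive : ∀ {j x π} → Marked j x π → 1 ≤ j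
Marked⇒positive {π = π} = greedy-positive (GG-greedy π)

SameMarkApart : ℕ × ℕ → ℕ × ℕ → Set
SameMarkApart (x , a) (y , b) = a ≡ b → a ≤ 2 → ¬ Conflicts x y

greedy-sameMarkApart : ∀ {G} → Greedy G → AllPairs SameMarkApart G
greedy-sameMarkApart []              = []
greedy-sameMarkApart (_∷_ x {acc} g) = All.tabulate apart ∷ greedy-sameMarkApart g
  where
  apart : ∀ {q} → q ∈ acc → SameMarkApart (x , smallestFree (conflictingMarks x acc)) q
  apart q∈ refl ≤2 c = smallestFree≤2⇒∉ _ ≤2 (∈-conflictingMarks⁺ q∈ c)

Sorted : List (ℕ × ℕ) → Set
Sorted = AllPairs (_≥_ on proj₁)

greedy-1-witness : ∀ {G x a} → Greedy G → Sorted G → (x , a) ∈ G → a ≢ 1 →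
  ∃ λ y → (y , 1) ∈ G × Conflicts x y × y ≤ x
greedy-1-witness (_ ∷ _) (x≥ ∷ _) (here refl) a≢1
  with ∈-conflictingMarks⁻ _ (smallestFree≢1⇒1∈ _ a≢1)
... | y , y1∈ , c = y , there y1∈ , c , All.lookup x≥ y1∈
greedy-1-witness (_ ∷ g) (_ ∷ sorted) (there m) a≢1 with greedy-1-witness g sorted m a≢1
... | y , y1∈ , c , y≤x = y , there y1∈ , c , y≤x

greedy-1-marked : ∀ {G x} → Greedy G → Sorted G → x ∈ map proj₁ G →
  (∀ {y} → (y , 1) ∈ G → y < x → ¬ Conflicts x y) → (x , 1) ∈ G
greedy-1-marked {x = x} (_∷_ z {acc} g) (z≥ ∷ sorted) x∈ unblocked with x ∈? map proj₁ acc | x∈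
... | yes x∈acc | _           = there (greedy-1-marked g sorted x∈acc (unblocked ∘′ there))
... | no  x∉acc | there x∈acc = ⊥-elim (x∉acc x∈acc)
... | no  x∉acc | here refl   = here (cong (x ,_) (sym (1∉⇒smallestFree≡1 _ 1∉)))
  where
  1∉ : 1 ∉ conflictingMarks x acc
  1∉ 1∈ with ∈-conflictingMarks⁻ acc 1∈
  ... | y , y1∈ , c with m≤n⇒m<n∨m≡n (All.lookup z≥ y1∈)
  ...   | inj₁ y<x  = unblocked (there y1∈) y<x c
  ...   | inj₂ refl = x∉acc (∈-map⁺ proj₁ y1∈)

nth-nonIncreasing⇒Linked : ∀ π → (∀ i → suc i < length π → nth π (suc i) ≤ nth π i) →
  Linked _≥_ π
nth-nonIncreasing⇒Linked []          _   = []
nth-nonIncreasing⇒Linked (x ∷ [])    _   = [-]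
nth-nonIncreasing⇒Linked (x ∷ y ∷ π) dec =
  dec 0 (s≤s (s≤s z≤n)) ∷ nth-nonIncreasing⇒Linked (y ∷ π) (λ i i< → dec (suc i) (s≤s i<))

GG-sorted : ∀ {π} → IsPartition π → Sorted (GG π)
GG-sorted {π} (_ , dec) =
  AllPairsₚ.map⁻ (subst (AllPairs _≥_) (sym (GG-parts π))
    (Linked⇒AllPairs (λ x≥y y≥z → ≤-trans y≥z x≥y) (nth-nonIncreasing⇒Linked π dec)))

Apart : ℕ → ℕ → Set
Apart x y = y < x × ¬ Conflicts x y

module _ {π : List ℕ} (π-partition : IsPartition π) where

  private
    greedy : Greedy (GG π)
    greedy = GG-greedy π

    sorted : Sorted (GG π)
    sorted = GG-sorted π-partition

    ordered : AllPairs (λ p q → SameMarkApart p q × proj₁ q ≤ proj₁ p) (GG π)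
    ordered = AllPairs.zip (greedy-sameMarkApart greedy , sorted)

  sameMark⇒¬Conflicts : ∀ {j x y} → j ≤ 2 → Marked j x π → Marked j y π → y < x →
    ¬ Conflicts x y
  sameMark⇒¬Conflicts j≤2 xj yj y<x with allPairs-either ordered xj yj (λ { refl → <-irrefl refl y<x })
  ... | inj₁ (apart , _) = apart refl j≤2
  ... | inj₂ (_ , x≤y)   = ⊥-elim (<⇒≱ y<x x≤y)

  ¬sameMark-+1 : ∀ {j x} → j ≤ 2 → Marked j (x + 1) π → ¬ Marked j x π
  ¬sameMark-+1 {x = x} j≤2 m m′ =
    sameMark⇒¬Conflicts j≤2 m m′ (m<m+n x ≤-refl) (≤+1⇒Conflicts {y = x} ≤-refl)

  conflicting-1-marked-below : ∀ {j x} → Marked j x π → j ≢ 1 →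
    ∃ λ y → Marked 1 y π × Conflicts x y × y ≤ x
  conflicting-1-marked-below = greedy-1-witness greedy sorted

  1-marked-if-unblocked : ∀ {x} → x ∈ π → (∀ {y} → Marked 1 y π → y < x → ¬ Conflicts x y) →
    Marked 1 x π
  1-marked-if-unblocked x∈ = greedy-1-marked greedy sorted (subst (_ ∈_) (sym (GG-parts π)) x∈)

  markedParts-apart : ∀ {j} → j ≤ 2 → AllPairs Apart (markedParts j π)
  markedParts-apart {j} j≤2 =
    AllPairsₚ.map⁺ (allPairs-restrict apart (all-filter markedj? (GG π))
                                            (AllPairsₚ.filter⁺ markedj? ordered))
    where
    markedj? : ∀ (q : ℕ × ℕ) → Dec (T (proj₂ q ≡ᵇ j))
    markedj? q = T? (proj₂ q ≡ᵇ j)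
    apart : ∀ {p q} → T (proj₂ p ≡ᵇ j) → T (proj₂ q ≡ᵇ j) →
      SameMarkApart p q × proj₁ q ≤ proj₁ p → Apart (proj₁ p) (proj₁ q)
    apart {x , a} {y , b} a≡ᵇj b≡ᵇj (sameMarkApart , y≤x) =
      ≤∧≢⇒< y≤x (λ { refl → ¬c (Conflicts-refl y) }) , ¬c
      where
      a≡j : a ≡ j
      a≡j = ≡ᵇ⇒≡ a j a≡ᵇj
      ¬c : ¬ Conflicts x y
      ¬c = sameMarkApart (trans a≡j (sym (≡ᵇ⇒≡ b j b≡ᵇj))) (subst (_≤ 2) (sym a≡j) j≤2)

markedParts-∈⇒Marked : ∀ {j x} π → x ∈ markedParts j π → Marked j x π
markedParts-∈⇒Marked {j} π x∈ with ∈-map⁻ proj₁ x∈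
... | (_ , a) , xa∈ , refl with ∈-filter⁻ (λ q → T? (proj₂ q ≡ᵇ j)) xa∈
...   | xa∈G , a≡ᵇj rewrite ≡ᵇ⇒≡ a j a≡ᵇj = xa∈G

-- The j-marked parts as an extended sequence

fin-injective : ∀ {a b} → fin a ≡ fin b → a ≡ b
fin-injective refl = refl

≤ᴱ-<-trans : ∀ e {a b} → e ≤ᴱ fin a → a < b → e <ᴱ fin b
≤ᴱ-<-trans minf    _   _   = tt
≤ᴱ-<-trans (fin x) x≤a a<b = ≤-<-trans x≤a a<b

<ᴱ-≤-trans : ∀ e {a b} → e <ᴱ fin a → a ≤ b → e <ᴱ fin b
<ᴱ-≤-trans minf    _   _   = tt
<ᴱ-≤-trans (fin x) x<a a≤b = <-≤-trans x<a a≤b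

≤-<ᴱ-trans : ∀ {a b} e → a ≤ b → fin b <ᴱ e → fin a <ᴱ e
≤-<ᴱ-trans (fin x) a≤b b<x = ≤-<-trans a≤b b<x
≤-<ᴱ-trans pinf    _   _   = tt

_≤ᴱfin?_ : ∀ e n → Dec (e ≤ᴱ fin n)
minf  ≤ᴱfin? n = yes tt
fin m ≤ᴱfin? n = m ≤? n
pinf  ≤ᴱfin? n = no (λ ())

fin_<ᴱ?_ : ∀ n e → Dec (fin n <ᴱ e)
fin n <ᴱ? minf  = no (λ ())
fin n <ᴱ? fin m = n <? m
fin n <ᴱ? pinf  = yes tt

_≟fin_ : ∀ e n → Dec (e ≡ fin n)
minf  ≟fin n = no (λ ())
pinf  ≟fin n = no (λ ())
fin m ≟fin n with m ≟ n
... | yes refl = yes refl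
... | no  m≢n  = no (λ eq → m≢n (fin-injective eq))

atE-∈ : ∀ xs i {a} → atE xs (suc i) ≡ fin a → a ∈ xs
atE-∈ (x ∷ xs) zero    refl = here refl
atE-∈ (x ∷ xs) (suc i) eq   = there (atE-∈ xs i eq)

atE⇒nth : ∀ xs i {a} → atE xs (suc i) ≡ fin a → nth xs i ≡ a
atE⇒nth (x ∷ xs) zero    refl = refl
atE⇒nth (x ∷ xs) (suc i) eq   = atE⇒nth xs i eq

atE⇒length : ∀ xs i {a} → atE xs (suc i) ≡ fin a → suc i ≤ length xs
atE⇒length (x ∷ xs) zero    refl = s≤s z≤n
atE⇒length (x ∷ xs) (suc i) eq   = s≤s (atE⇒length xs i eq)

atE-pred : ∀ {R : ℕ → ℕ → Set} xs i {b} → AllPairs R xs → atE xs (suc (suc i)) ≡ fin b →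
  ∃ λ a → atE xs (suc i) ≡ fin a × R a b
atE-pred (x ∷ y ∷ xs) zero    ((Rxy ∷ _) ∷ _) refl = x , refl , Rxy
atE-pred (x ∷ xs)     (suc i) (_ ∷ Rxs)       eq   = atE-pred xs i Rxs eq

atE-injective : ∀ xs i j {a} → AllPairs _>_ xs → atE xs i ≡ fin a → atE xs j ≡ fin a → i ≡ j
atE-injective (x ∷ xs) (suc zero)    (suc zero)    _         refl _    = refl
atE-injective (x ∷ xs) (suc zero)    (suc (suc j)) (x> ∷ _)  refl eq   =
  ⊥-elim (<-irrefl refl (All.lookup x> (atE-∈ xs j eq)))
atE-injective (x ∷ xs) (suc (suc i)) (suc zero)    (x> ∷ _)  eq   refl =
  ⊥-elim (<-irrefl refl (All.lookup x> (atE-∈ xs i eq)))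
atE-injective (x ∷ xs) (suc (suc i)) (suc (suc j)) (_ ∷ >xs) eq   eq′  =
  cong suc (atE-injective xs (suc i) (suc j) >xs eq eq′)

fin≤ᴱatE⇒ : ∀ xs i {n} → fin n ≤ᴱ atE xs (suc i) → ∃ λ a → atE xs (suc i) ≡ fin a × n ≤ a
fin≤ᴱatE⇒ (x ∷ xs) zero    n≤x = x , refl , n≤x
fin≤ᴱatE⇒ (x ∷ xs) (suc i) n≤  = fin≤ᴱatE⇒ xs i n≤

fin≮ᴱatE⇒ : ∀ xs i {n} → ¬ (fin n <ᴱ atE xs (suc i)) → atE xs (suc i) ≤ᴱ fin n
fin≮ᴱatE⇒ []       i       _   = tt
fin≮ᴱatE⇒ (x ∷ xs) zero    n≮x = ≮⇒≥ n≮x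
fin≮ᴱatE⇒ (x ∷ xs) (suc i) n≮  = fin≮ᴱatE⇒ xs i n≮

P-marked : ∀ {j} π i {x} → P j π (suc i) ≡ fin x → Marked j x π
P-marked {j} π i eq = markedParts-∈⇒Marked π (atE-∈ (markedParts j π) i eq)

-- Starting types

Marked? : ∀ j x π → Dec (Marked j x π)
Marked? j x π = (x , j) ∈ₚ? GG π

NoOddGe? : ∀ π l → Dec (NoOddGe π l)
NoOddGe? π l with All.all? (λ y → T? (isOdd y) →-dec ¬? (P 2 π l ≤ᴱfin? y)) π
... | yes all = yes (λ y y∈ → All.lookup all y∈)
... | no ¬all = no (λ noOddGe → ¬all (All.tabulate (λ {y} y∈ → noOddGe y y∈)))

IsL-exists : ∀ π → ∃ (IsL π)
IsL-exists π = largest-≤ (NoOddGe? π) (λ _ _ _ ()) (N 2 π)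

IsL-unique : ∀ {π l l′} → IsL π l → IsL π l′ → l ≡ l′
IsL-unique (l≤ , noOdd , maximal) (l′≤ , noOdd′ , maximal′) =
  ≤-antisym (maximal′ _ l≤ noOdd) (maximal _ l′≤ noOdd′)

InL? : ∀ π b → Dec (InL π b)
InL? π b with IsL-exists π
... | l , isL with 1 ≤? b | b ≤? l
...   | yes 1≤b | yes b≤l = yes (1≤b , l , isL , b≤l)
...   | no  1≰b | _       = no (λ inL → 1≰b (proj₁ inL))
...   | yes _   | no  b≰l =
  no (λ { (_ , l′ , isL′ , b≤l′) → b≰l (subst (b ≤_) (IsL-unique isL′ isL) b≤l′) })

mutual
  HasType? : ∀ π b c → Dec (HasType π b c)
  HasType? π b c = InL? π b ×-dec TypeCond? π b c

  SIs? : ∀ π b v → Dec (SIs π b v)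
  SIs? π b v with withValue s0 | withValue s1 | withValue s2 | withValue s3
    where
    withValue : ∀ c → Dec (HasType π b c × sval (P2 π b) c ≡ v)
    withValue c = HasType? π b c ×-dec (sval (P2 π b) c ≟ v)
  ... | yes h | _     | _     | _     = yes (s0 , h)
  ... | no _  | yes h | _     | _     = yes (s1 , h)
  ... | no _  | no _  | yes h | _     = yes (s2 , h)
  ... | no _  | no _  | no _  | yes h = yes (s3 , h)
  ... | no ¬0 | no ¬1 | no ¬2 | no ¬3 =
    no λ { (s0 , h) → ¬0 h ; (s1 , h) → ¬1 h ; (s2 , h) → ¬2 h ; (s3 , h) → ¬3 h }

  TypeCond? : ∀ π b c → Dec (TypeCond π b c)
  TypeCond? π zero            c  = no (λ ())
  TypeCond? π (suc zero)      s0 = Marked? 1 (P2 π 1 ∸ 1) π ×-dec ¬? (P2 π 1 + 2 ∈? π)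
  TypeCond? π (suc zero)      s1 = Marked? 1 (P2 π 1 ∸ 2) π ×-dec ¬? (P2 π 1 + 2 ∈? π)
  TypeCond? π (suc zero)      s2 = Marked? 1 (P2 π 1 + 2) π
  TypeCond? π (suc zero)      s3 = Marked? 1 (P2 π 1) π
  TypeCond? π b@(suc (suc n)) s0 =
    Marked? 1 (P2 π b ∸ 1) π ×-dec (Marked? 1 (P2 π b + 2) π →-dec SIs? π (suc n) (P2 π b + 2))
  TypeCond? π b@(suc (suc n)) s1 =
    Marked? 1 (P2 π b ∸ 2) π ×-dec (Marked? 1 (P2 π b + 2) π →-dec SIs? π (suc n) (P2 π b + 2))
  TypeCond? π b@(suc (suc n)) s2 =
    Marked? 1 (P2 π b + 2) π ×-dec ¬? (SIs? π (suc n) (P2 π b + 2))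
  TypeCond? π b@(suc (suc n)) s3 = Marked? 1 (P2 π b) π

InL-above-odd : ∀ {π} i {x} → P 2 π (suc i) ≡ fin x → (∀ y → y ∈ π → Odd y → y < x) →
  InL π (suc i)
InL-above-odd {π} i eq odd< with IsL-exists π
... | l , isL@(_ , _ , maximal) =
  s≤s z≤n , l , isL , maximal (suc i) (atE⇒length (markedParts 2 π) i eq) noOddGe
  where
  noOddGe : NoOddGe π (suc i)
  noOddGe y y∈ odd x≤y = <⇒≱ (odd< y y∈ odd) (subst (_≤ᴱ fin y) eq x≤y)

typeCond-s3 : ∀ π i → Marked 1 (P2 π (suc i)) π → TypeCond π (suc i) s3
typeCond-s3 π zero    m = m
typeCond-s3 π (suc i) m = m

typeCond-s1⇒1-marked : ∀ π i → TypeCond π (suc i) s1 → Marked 1 (P2 π (suc i) ∸ 2) π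
typeCond-s1⇒1-marked π zero    (m , _) = m
typeCond-s1⇒1-marked π (suc i) (m , _) = m

-- Partitions in ℂ_=(k,r|p,t)

largest-next-below : ∀ xs {p q m′} → q ≤ p → p < m′ →
  (∀ q′ → q′ ≤ p → fin (2 * (m′ ∸ q′) + 1) <ᴱ atE xs q′ → q′ ≤ q) →
  q ≡ p ⊎ atE xs (suc q) <ᴱ fin (2 * (m′ ∸ q))
largest-next-below xs {p} {q} {m′} q≤p p<m′ maximal with m≤n⇒m<n∨m≡n q≤p
... | inj₂ q≡p = inj₁ q≡p
... | inj₁ q<p = inj₂ (≤ᴱ-<-trans _ (fin≮ᴱatE⇒ xs q not-above) bound)
  where
  not-above : ¬ (fin (2 * (m′ ∸ suc q) + 1) <ᴱ atE xs (suc q))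
  not-above above = 1+n≰n (maximal (suc q) q<p above)
  m′∸q≡ : m′ ∸ q ≡ suc (m′ ∸ suc q)
  m′∸q≡ = +-∸-assoc 1 (<-trans q<p p<m′)
  bound : 2 * (m′ ∸ suc q) + 1 < 2 * (m′ ∸ q)
  bound = subst (λ x → 2 * (m′ ∸ suc q) + 1 < 2 * x) (sym m′∸q≡) (2s+1<2*suc (m′ ∸ suc q))

module _ {k r p t : ℕ} {π : List ℕ} (ceq : InCeq k r p t π) where

  private
    xs : List ℕ
    xs = markedParts 2 π

    P₂ : ℕ → Ext
    P₂ = P 2 π

    inC : InC k r π
    inC = proj₁ ceq

    partition : IsPartition π
    partition = proj₁ inC

    2t+1∈π : 2 * t + 1 ∈ π
    2t+1∈π = proj₁ (proj₁ (proj₂ ceq))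

    odd≤2t+1 : ∀ y → y ∈ π → Odd y → y ≤ 2 * t + 1
    odd≤2t+1 = proj₂ (proj₁ (proj₂ ceq))

    mark[2t+1]≤2 : ∃ λ j → Marked j (2 * t + 1) π × j ≤ 2
    mark[2t+1]≤2 = proj₁ (proj₂ (proj₂ ceq))

    P₂p≥2t+2 : fin (2 * t + 2) ≤ᴱ P₂ p
    P₂p≥2t+2 = proj₁ (proj₂ (proj₂ (proj₂ ceq)))

    P₂[p+1]≤2t+2 : P₂ (suc p) ≤ᴱ fin (2 * t + 2)
    P₂[p+1]≤2t+2 = proj₁ (proj₂ (proj₂ (proj₂ (proj₂ ceq))))

    s0⇒P₂[p+1]≡2t+2 : TwoMarkedOfType π (2 * t + 2) s0 → P₂ (suc p) ≡ fin (2 * t + 2)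
    s0⇒P₂[p+1]≡2t+2 of-s0 = proj₁ (proj₁ (proj₂ (proj₂ (proj₂ (proj₂ (proj₂ ceq))))) of-s0)

    s2⇒P₂p≡2t+2 : TwoMarkedOfType π (2 * t + 2) s2 → P₂ p ≡ fin (2 * t + 2)
    s2⇒P₂p≡2t+2 = proj₁ (proj₂ (proj₂ (proj₂ (proj₂ (proj₂ (proj₂ ceq))))))

    apart : AllPairs Apart xs
    apart = markedParts-apart partition ≤-refl

  odd⇒≤2t+1 : ∀ {y} → y ∈ π → isOdd y ≡ true → y ≤ 2 * t + 1
  odd⇒≤2t+1 y∈ odd = odd≤2t+1 _ y∈ (subst T (sym odd) tt)

  >2t+1⇒even : ∀ {y} → y ∈ π → 2 * t + 1 < y → isOdd y ≡ false
  >2t+1⇒even {y} y∈ 2t+1<y with isOdd y in odd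
  ... | false = refl
  ... | true  = ⊥-elim (<⇒≱ 2t+1<y (odd⇒≤2t+1 y∈ odd))

  P₂-InL : ∀ i {x} → P₂ (suc i) ≡ fin x → 2 * t + 1 < x → InL π (suc i)
  P₂-InL i eq 2t+1<x = InL-above-odd i eq (λ y y∈ odd → ≤-<-trans (odd≤2t+1 y y∈ odd) 2t+1<x)

  P₂-injective : ∀ {i j x} → P₂ i ≡ fin x → P₂ j ≡ fin x → i ≡ j
  P₂-injective = atE-injective xs _ _ (AllPairs.map proj₁ apart)

  ¬sameMark[2t+2,2t+1] : ∀ {j} → j ≤ 2 → Marked j (2 * t + 2) π → ¬ Marked j (2 * t + 1) π
  ¬sameMark[2t+2,2t+1] {j} j≤2 m =
    ¬sameMark-+1 partition j≤2 (subst (λ x → Marked j x π) (sym (+-assoc (2 * t) 1 1)) m)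

  2-marked[2t+2]⇒1-marked[2t+1] : Marked 2 (2 * t + 2) π → Marked 1 (2 * t + 1) π
  2-marked[2t+2]⇒1-marked[2t+1] m2 with mark[2t+1]≤2
  ... | 0 , m0 , _                          = ⊥-elim (1+n≰n (Marked⇒positive {π = π} m0))
  ... | 1 , m1 , _                          = m1
  ... | 2 , m2′ , _                         = ⊥-elim (¬sameMark[2t+2,2t+1] ≤-refl m2 m2′)
  ... | suc (suc (suc _)) , _ , s≤s (s≤s ())

  2t+2-not-s1 : ∀ i → P₂ (suc i) ≡ fin (2 * t + 2) → ¬ TypeCond π (suc i) s1
  2t+2-not-s1 i eq of-s1 = ¬sameMark-+1 partition (s≤s z≤n) m[2t+1] m[2t]
    where
    m[2t+1] : Marked 1 (2 * t + 1) π
    m[2t+1] = 2-marked[2t+2]⇒1-marked[2t+1] (P-marked π i eq)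
    m[2t] : Marked 1 (2 * t) π
    m[2t] = subst (λ y → Marked 1 y π)
                  (trans (cong (_∸ 2) (atE⇒nth xs i eq)) (m+n∸n≡m (2 * t) 2))
                  (typeCond-s1⇒1-marked π i of-s1)

  P₂-gap : ∀ i {b} → P₂ (suc (suc i)) ≡ fin b → 2 * t + 1 < b →
    ∃ λ a → P₂ (suc i) ≡ fin a × b + 2 < a
  P₂-gap i eq 2t+1<b with atE-pred xs i apart eq
  ... | a , eqa , b<a , ¬c =
    a , eqa , ¬Conflicts-even⇒< (>2t+1⇒even (Marked⇒∈ (P-marked π i eqa)) (<-trans 2t+1<b b<a)) ¬c

  P₂-pred-gap : ∀ i {b} → P₂ (suc i) ≡ fin b → 2 * t + 1 < b → fin (b + 2) <ᴱ P₂ i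
  P₂-pred-gap zero    _  _      = tt
  P₂-pred-gap (suc i) eq 2t+1<b with P₂-gap i eq 2t+1<b
  ... | a , eqa , b+2<a = subst (fin _ <ᴱ_) (sym eqa) b+2<a

  P₂-gaps : ∀ d i {b} → P₂ (suc i + d) ≡ fin b → 2 * t + 1 < b →
    ∃ λ a → P₂ (suc i) ≡ fin a × b + 3 * d ≤ a
  P₂-gaps zero    i {b} eq _ =
    b , subst (λ j → P₂ j ≡ fin b) (+-identityʳ (suc i)) eq , ≤-reflexive (+-identityʳ b)
  P₂-gaps (suc d) i {b} eq 2t+1<b
    with P₂-gaps d (suc i) (subst (λ j → P₂ j ≡ fin b) (+-suc (suc i) d) eq) 2t+1<b
  ... | a′ , eqa′ , b+3d≤a′
    with P₂-gap i eqa′ (<-≤-trans 2t+1<b (≤-trans (m≤m+n b (3 * d)) b+3d≤a′))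
  ...   | a , eqa , a′+2<a = a , eqa , (begin
    b + 3 * suc d  ≡⟨ step b d ⟩
    b + 3 * d + 3  ≤⟨ +-monoˡ-≤ 3 b+3d≤a′ ⟩
    a′ + 3         ≡⟨ +-suc a′ 2 ⟩
    suc (a′ + 2)   ≤⟨ a′+2<a ⟩
    a              ∎)
    where
    open ≤-Reasoning
    step : ∀ b d → b + 3 * suc d ≡ b + 3 * d + 3
    step = solve-∀

  InClt⇒t<t′ : ∀ {p′ t′} → InClt k r p′ t′ π → t < t′
  InClt⇒t<t′ (_ , odd<2t′+1 , _) =
    2t+1<2t′+1⇒t<t′ (odd<2t′+1 _ 2t+1∈π (subst T (sym (isOdd-2*+1 t)) tt))

  InClt-with-p′<p⇒< : ∀ {p′ t′} d → suc p′ + d ≡ p → InClt k r p′ t′ π → suc d + t < t′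
  InClt-with-p′<p⇒< {p′} {t′} d p≡ (_ , _ , P₂[p′+1]< , _ , _ , s0⊎s1)
    with fin≤ᴱatE⇒ xs (p′ + d) (subst (λ i → fin (2 * t + 2) ≤ᴱ P₂ i) (sym p≡) P₂p≥2t+2)
  ... | b , eqb , 2t+2≤b with P₂-gaps d p′ eqb (<-≤-trans (2t+1<2t+2 t) 2t+2≤b)
  ...   | a , eqa , b+3d≤a with suc d + t <? t′
  ...     | yes lt = lt
  ...     | no ¬lt
    with squeeze {t} {t′} (≤-trans (+-monoˡ-≤ (3 * d) 2t+2≤b) b+3d≤a)
                          (<+1⇒≤ (subst (_<ᴱ fin (2 * t′ + 1)) eqa P₂[p′+1]<)) (≮⇒≥ ¬lt)
  ...       | refl , 2t′≡2t+2 with s0⊎s1 (trans eqa (cong fin (sym 2t′≡2t+2)))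
  ...         | inj₂ (_ , of-s1) = ⊥-elim (2t+2-not-s1 p′ eqa of-s1)
  ...         | inj₁ of-s0       =
    ⊥-elim (<-irrefl (suc-injective (P₂-injective eqa (s0⇒P₂[p+1]≡2t+2 (suc p′ , eqa , of-s0))))
                     (subst (p′ <_) p≡ (m≤m+n (suc p′) d)))

  InClt⇒< : ∀ {p′ t′} → InClt k r p′ t′ π → p + t < p′ + t′
  InClt⇒< {p′} {t′} clt with p ≤? p′
  ... | yes p≤p′ = +-mono-≤-< p≤p′ (InClt⇒t<t′ clt)
  ... | no  p≰p′ with m≤n⇒∃[o]m+o≡n (≰⇒> p≰p′)
  ...   | d , p≡ = begin-strict
    p + t             ≡⟨ cong (_+ t) p≡ ⟨
    suc p′ + d + t    ≡⟨ shift p′ d t ⟩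
    p′ + (suc d + t)  <⟨ +-monoʳ-< p′ (InClt-with-p′<p⇒< d p≡ clt) ⟩
    p′ + t′           ∎
    where
    open ≤-Reasoning
    shift : ∀ p′ d t → suc p′ + d + t ≡ p′ + (suc d + t)
    shift = solve-∀

  1-marked-two-above : ∀ {v} → isOdd v ≡ false → 2 * t < v → v + 2 ∈ π → ¬ Marked 1 v π →
    Marked 1 (v + 2) π
  1-marked-two-above {v} even 2t<v v+2∈ ¬m = 1-marked-if-unblocked partition v+2∈ unblocked
    where
    v+1-odd : isOdd (suc v) ≡ true
    v+1-odd = trans (isOdd-suc v) (cong not even)
    unblocked : ∀ {y} → Marked 1 y π → y < v + 2 → ¬ Conflicts (v + 2) y
    unblocked {y} m y<v+2 c
      with between⇒≡∨≡suc∨≡+2 (+-cancelʳ-≤ 2 v y (Conflicts-even⇒≤ (trans (isOdd-+2 v) even) c))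
                              (<⇒≤ y<v+2)
    ... | inj₁ refl        = ¬m m
    ... | inj₂ (inj₁ refl) = <⇒≱ 2t<v (<+1⇒≤ (odd⇒≤2t+1 (Marked⇒∈ m) v+1-odd))
    ... | inj₂ (inj₂ refl) = <-irrefl refl y<v+2

  1-marked-two-below : ∀ {v} → Marked 2 v π → isOdd v ≡ false → 2 * t + 2 < v →
    ¬ Marked 1 v π → Marked 1 (v ∸ 2) π
  1-marked-two-below {v} m2 even 2t+2<v ¬m with conflicting-1-marked-below partition m2 (λ ())
  ... | y , m , c , y≤v with between⇒≡∨≡suc∨≡+2 y≤v (Conflicts-even⇒≤ even c)
  ...   | inj₁ refl        = ⊥-elim (¬m m)
  ...   | inj₂ (inj₁ refl) =
    ⊥-elim (<⇒≱ (<-≤-trans (2t+1<2t+2 t) (≤-pred 2t+2<v)) (odd⇒≤2t+1 (Marked⇒∈ m) y-odd))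
    where
    y-odd : isOdd y ≡ true
    y-odd = not-injective (trans (sym (isOdd-suc y)) even)
  ...   | inj₂ (inj₂ refl) = subst (λ x → Marked 1 x π) (sym (m+n∸n≡m y 2)) m

  2t+2-s2⇒at-p : ∀ {b} → P₂ b ≡ fin (2 * t + 2) → HasType π b s2 → b ≡ p
  2t+2-s2⇒at-p eq of-s2 = P₂-injective eq (s2⇒P₂p≡2t+2 (_ , eq , of-s2))

  2t+2-neighbours : ∀ i → P₂ (suc i) ≡ fin (2 * t + 2) →
    Marked 1 (P2 π (suc i) ∸ 1) π × (P2 π (suc i) + 2 ∈ π → Marked 1 (P2 π (suc i) + 2) π)
  2t+2-neighbours i eq rewrite atE⇒nth xs i eq =
    subst (λ x → Marked 1 x π) (sym (+-∸-assoc (2 * t) {2} {1} (s≤s z≤n))) m[2t+1] ,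
    λ v+2∈ → 1-marked-two-above (isOdd-2*+2 t) (m<m+n (2 * t) (s≤s z≤n)) v+2∈
               (λ m → ¬sameMark[2t+2,2t+1] (s≤s z≤n) m m[2t+1])
    where
    m[2t+1] : Marked 1 (2 * t + 1) π
    m[2t+1] = 2-marked[2t+2]⇒1-marked[2t+1] (P-marked π i eq)

  2t+2-type-s0 : ∀ i → suc i ≢ p → P₂ (suc i) ≡ fin (2 * t + 2) → HasType π (suc i) s0
  2t+2-type-s0 zero ≢p eq with 2t+2-neighbours zero eq
  ... | m[v∸1] , v+2-marked =
    inL , m[v∸1] , λ v+2∈ → ≢p (2t+2-s2⇒at-p eq (inL , v+2-marked v+2∈))
    where
    inL : InL π 1
    inL = P₂-InL zero eq (2t+1<2t+2 t)
  2t+2-type-s0 (suc n) ≢p eq with 2t+2-neighbours (suc n) eq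
  ... | m[v∸1] , _ =
    inL , m[v∸1] ,
    λ M → decidable-stable (SIs? π (suc n) _) (λ ¬s → ≢p (2t+2-s2⇒at-p eq (inL , M , ¬s)))
    where
    inL : InL π (suc (suc n))
    inL = P₂-InL (suc n) eq (2t+1<2t+2 t)

  unmarked-above-2t+2-facts : ∀ i {t′} → t < t′ → P₂ (suc i) ≡ fin (2 * t′ + 2) →
    ¬ Marked 1 (P2 π (suc i)) π →
    InL π (suc i) × Marked 1 (P2 π (suc i) ∸ 2) π ×
    (P2 π (suc i) + 2 ∈ π → Marked 1 (P2 π (suc i) + 2) π)
  unmarked-above-2t+2-facts i {t′} t<t′ eq ¬m =
    P₂-InL i eq (t<t′⇒2t+1<2t′+2 t<t′) ,
    1-marked-two-below m2 even 2t+2<v ¬m ,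
    λ v+2∈ → 1-marked-two-above even (<-trans (m<m+n (2 * t) (s≤s z≤n)) 2t+2<v) v+2∈ ¬m
    where
    v≡ : P2 π (suc i) ≡ 2 * t′ + 2
    v≡ = atE⇒nth xs i eq
    even : isOdd (P2 π (suc i)) ≡ false
    even = trans (cong isOdd v≡) (isOdd-2*+2 t′)
    2t+2<v : 2 * t + 2 < P2 π (suc i)
    2t+2<v = subst (2 * t + 2 <_) (sym v≡) (t<t′⇒2t+2<2t′+2 t<t′)
    m2 : Marked 2 (P2 π (suc i)) π
    m2 = subst (λ x → Marked 2 x π) (sym v≡) (P-marked π i eq)

  unmarked-above-2t+2-type : ∀ i {t′} → t < t′ → P₂ (suc i) ≡ fin (2 * t′ + 2) →
    ¬ Marked 1 (P2 π (suc i)) π → HasType π (suc i) s2 ⊎ HasType π (suc i) s1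
  unmarked-above-2t+2-type zero t<t′ eq ¬m with unmarked-above-2t+2-facts zero t<t′ eq ¬m
  ... | inL , m[v∸2] , v+2-marked with Marked? 1 (P2 π 1 + 2) π | P2 π 1 + 2 ∈? π
  ...   | yes M | _        = inj₁ (inL , M)
  ...   | no ¬M | no v+2∉  = inj₂ (inL , m[v∸2] , v+2∉)
  ...   | no ¬M | yes v+2∈ = ⊥-elim (¬M (v+2-marked v+2∈))
  unmarked-above-2t+2-type (suc n) t<t′ eq ¬m with unmarked-above-2t+2-facts (suc n) t<t′ eq ¬m
  ... | inL , m[v∸2] , _ with Marked? 1 (P2 π (suc (suc n)) + 2) π
  ...   | no ¬M = inj₂ (inL , m[v∸2] , λ M → ⊥-elim (¬M M))
  ...   | yes M with SIs? π (suc n) (P2 π (suc (suc n)) + 2)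
  ...     | yes s = inj₂ (inL , m[v∸2] , λ _ → s)
  ...     | no ¬s = inj₁ (inL , M , ¬s)

  upper-boundary : ∀ q {t′} → t < t′ →
    (P₂ q ≡ fin (2 * t′ + 2) → HasType π q s2 ⊎ HasType π q s3) ⊎
    ∃ λ q₀ → q ≡ suc q₀ × P₂ (suc q₀) ≡ fin (2 * t′ + 2) × HasType π (suc q₀) s1
  upper-boundary zero          _    = inj₁ (λ ())
  upper-boundary (suc q₀) {t′} t<t′ with P₂ (suc q₀) ≟fin (2 * t′ + 2)
  ... | no  ≢ = inj₁ (λ eq → ⊥-elim (≢ eq))
  ... | yes eq with Marked? 1 (P2 π (suc q₀)) π
  ...   | yes m =
    inj₁ (λ _ → inj₂ (P₂-InL q₀ eq (t<t′⇒2t+1<2t′+2 t<t′) , typeCond-s3 π q₀ m))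
  ...   | no ¬m with unmarked-above-2t+2-type q₀ t<t′ eq ¬m
  ...     | inj₁ of-s2 = inj₁ (λ _ → inj₁ of-s2)
  ...     | inj₂ of-s1 = inj₂ (q₀ , refl , eq , of-s1)

  candidate-below : ∀ {q t′} → t < t′ → q ≡ p ⊎ P₂ (suc q) <ᴱ fin (2 * t′) →
    P₂ (suc q) <ᴱ fin (2 * t′ + 1) ×
    (P₂ (suc q) ≡ fin (2 * t′) → HasType π (suc q) s0 ⊎ HasType π (suc q) s1)
  candidate-below {t′ = t′} t<t′ (inj₁ refl) =
    ≤ᴱ-<-trans _ P₂[p+1]≤2t+2 (≤-<-trans (t<t′⇒2t+2≤2t′ t<t′) (m<m+n (2 * t′) (s≤s z≤n))) ,
    λ eq → inj₁ (2t+2-type-s0 p 1+n≢n (trans eq (cong fin (2t′≡2t+2 eq))))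
    where
    2t′≡2t+2 : P₂ (suc p) ≡ fin (2 * t′) → 2 * t′ ≡ 2 * t + 2
    2t′≡2t+2 eq =
      ≤-antisym (subst (_≤ᴱ fin (2 * t + 2)) eq P₂[p+1]≤2t+2) (t<t′⇒2t+2≤2t′ t<t′)
  candidate-below {t′ = t′} t<t′ (inj₂ P₂[q+1]<2t′) =
    <ᴱ-≤-trans _ P₂[q+1]<2t′ (m≤m+n (2 * t′) 1) ,
    λ eq → ⊥-elim (<-irrefl refl (subst (_<ᴱ fin (2 * t′)) eq P₂[q+1]<2t′))

  candidate : ∀ {q t′} → t < t′ → fin (2 * t′ + 1) <ᴱ P₂ q →
    q ≡ p ⊎ P₂ (suc q) <ᴱ fin (2 * t′) →
    (P₂ q ≡ fin (2 * t′ + 2) → HasType π q s2 ⊎ HasType π q s3) → InClt k r q t′ π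
  candidate {q} {t′} t<t′ above below upper with candidate-below t<t′ below
  ... | P₂[q+1]<2t′+1 , s0⊎s1 = inC , odd< , P₂[q+1]<2t′+1 , above , upper , s0⊎s1
    where
    odd< : ∀ y → y ∈ π → Odd y → y < 2 * t′ + 1
    odd< y y∈ odd = ≤-<-trans (odd≤2t+1 y y∈ odd) (t<t′⇒2t+1<2t′+1 t<t′)

  shifted : ∀ {q₀ t′} → t < t′ → P₂ (suc q₀) ≡ fin (2 * t′ + 2) → HasType π (suc q₀) s1 →
    InClt k r q₀ (suc t′) π
  shifted {q₀} {t′} t<t′ eq of-s1 =
    inC , odd< , below , above , (λ eq′ → ⊥-elim (not-2t′+4 eq′)) , (λ _ → inj₂ of-s1)
    where
    odd< : ∀ y → y ∈ π → Odd y → y < 2 * suc t′ + 1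
    odd< y y∈ odd = ≤-<-trans (odd≤2t+1 y y∈ odd) (t<t′⇒2t+1<2t′+1 (m<n⇒m<1+n t<t′))
    below : P₂ (suc q₀) <ᴱ fin (2 * suc t′ + 1)
    below = subst (_<ᴱ fin (2 * suc t′ + 1)) (sym eq) (2t+2<2*suc+1 t′)
    P₂q₀> : fin (2 * t′ + 2 + 2) <ᴱ P₂ q₀
    P₂q₀> = P₂-pred-gap q₀ eq (t<t′⇒2t+1<2t′+2 t<t′)
    2*suc+1≤ : 2 * suc t′ + 1 ≤ 2 * t′ + 2 + 2
    2*suc+1≤ = <⇒≤ (subst (2 * suc t′ + 1 <_) (sym (2t+2+2≡2*suc+2 t′)) (2t+1<2t+2 (suc t′)))
    above : fin (2 * suc t′ + 1) <ᴱ P₂ q₀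
    above = ≤-<ᴱ-trans (P₂ q₀) 2*suc+1≤ P₂q₀>
    not-2t′+4 : ¬ P₂ q₀ ≡ fin (2 * suc t′ + 2)
    not-2t′+4 eq′ = <-irrefl (2t+2+2≡2*suc+2 t′) (subst (fin (2 * t′ + 2 + 2) <ᴱ_) eq′ P₂q₀>)

  <⇒InCltM : ∀ {m′} → p + t < m′ → InCltM k r m′ π
  <⇒InCltM {m′} p+t<m′ with largest-≤ (λ q → fin (2 * (m′ ∸ q) + 1) <ᴱ? P₂ q) tt p
  ... | q , q≤p , above , maximal with upper-boundary q (t<m′∸q q≤p p+t<m′)
  ...   | inj₁ upper =
    q , m′ ∸ q , q+[m′∸q]≡m′ q≤p p+t<m′ ,
    candidate (t<m′∸q q≤p p+t<m′) above
              (largest-next-below xs q≤p (≤-<-trans (m≤m+n p t) p+t<m′) maximal) upper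
  ...   | inj₂ (q₀ , refl , eq , of-s1) =
    q₀ , suc (m′ ∸ suc q₀) , trans (+-suc q₀ _) (q+[m′∸q]≡m′ q≤p p+t<m′) ,
    shifted (t<m′∸q q≤p p+t<m′) eq of-s1

theorem5p8 : (k r m : ℕ) → 3 ≤ r → r ≤ k → (π : List ℕ) →
    InCeqM k r m π → (m' : ℕ) → (InCltM k r m' π ⇔ m < m')
theorem5p8 k r m _ _ π (p , t , p+t≡m , ceq) m′ = mk⇔
  (λ (_ , _ , p′+t′≡m′ , clt) → subst₂ _<_ p+t≡m p′+t′≡m′ (InClt⇒< {k} {r} ceq clt))
  (λ m<m′ → <⇒InCltM {k} {r} ceq (subst (_< m′) (sym p+t≡m) m<m′))
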